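{- Let $r\geqslant 2$ and $n\geqslant 2r-1$ be integers. Then there exists $\pi\in\mathrm{Sym}_n$ with $w_H(\pi)=2r-1$ such that $$I(n,2r-1,r)=|B_r(\pi)\cap B_r(I_n)|=\sum_{i=0}^{r}|\{\sigma\in\mathrm{Sym}_n: w_H(\sigma)=i,\ d(\sigma,\pi)\leqslant r\}|.$$ Moreover, for this $\pi$, every $\sigma\in B_r(\pi)\cap B_r(I_n)$ satisfies one of: (i) $Tc(\sigma)\subset Tc(\pi)$ and $|Tc(\sigma)|=r-1$; (ii) $Tc(\sigma)\subset Tc(\pi)$ and $|Tc(\sigma)|=r$; (iii) $|Tc(\sigma)\cap Tc(\pi)|=r-1$ and $|Tc(\sigma)|=r$.
   Context: $\mathrm{Sym}_n$ is the symmetric group on $[n]=\{1,\dots,n\}$, $I_n$ its identity, $d(\pi,\tau)=|\{i\in[n]:\pi(i)\neq\tau(i)\}|$ the Hamming distance, $w_H(\pi)=d(I_n,\pi)$, $B_r(\pi)=\{\sigma\in\mathrm{Sym}_n:d(\pi,\sigma)\leqslant r\}$, and $I(n,d,r)=\max\{|B_r(\pi)\cap B_r(\tau)| : \pi,\tau\in\mathrm{Sym}_n,\ d(\pi,\tau)=d\}$. For $\pi\in\mathrm{Sym}_n$, $Tc(\pi)=\{(i,\pi(i)) : i\in[n],\ \pi(i)\neq i\}$. -}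

module Defs where

open import Data.Nat using (ℕ; zero; suc; _≤_; _≤?_; _⊔_)
open import Data.Fin using (Fin)
open import Data.Fin.Properties using (all?) renaming (_≟_ to _≟ᶠ_)
open import Data.Vec using (Vec; []; _∷_; lookup)
import Data.Vec as Vec
open import Data.List using (List; [_]; map; concatMap; filter; length; foldr; cartesianProduct)
import Data.List as List
open import Data.Product using (_×_; _,_; proj₁; proj₂)
open import Data.Product.Properties using (≡-dec)
open import Relation.Binary.PropositionalEquality using (_≡_)
open import Relation.Nullary using (¬?; _→-dec_)
open import Relation.Nullary.Decidable using (_×-dec_)
import Data.List.Membership.DecPropositional as DecMem

-- A permutation of [n] is represented by its one-line notation:
-- a vector π with π(i) = lookup π i, required to be injective (hence bijective).
RawPerm : ℕ → Set
RawPerm n = Vec (Fin n) n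

IsPerm : ∀ {n} → RawPerm n → Set
IsPerm {n} π = ∀ (i j : Fin n) → lookup π i ≡ lookup π j → i ≡ j

isPerm? : ∀ {n} (π : RawPerm n) → Relation.Nullary.Dec (IsPerm π)
isPerm? π = all? (λ i → all? (λ j → (lookup π i ≟ᶠ lookup π j) →-dec (i ≟ᶠ j)))

allVecs : ∀ m k → List (Vec (Fin m) k)
allVecs m zero = [ [] ]
allVecs m (suc k) = concatMap (λ x → map (x ∷_) (allVecs m k)) (List.allFin m)

Sym : ∀ n → List (RawPerm n)
Sym n = filter isPerm? (allVecs n n)

idPerm : ∀ n → RawPerm n
idPerm n = Vec.allFin n

dist : ∀ {n} → RawPerm n → RawPerm n → ℕ
dist {n} π τ = length (filter (λ i → ¬? (lookup π i ≟ᶠ lookup τ i)) (List.allFin n))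

wH : ∀ {n} → RawPerm n → ℕ
wH {n} π = dist (idPerm n) π

interCard : ∀ n → ℕ → RawPerm n → RawPerm n → ℕ
interCard n r π τ =
  length (filter (λ σ → (dist π σ ≤? r) ×-dec (dist τ σ ≤? r)) (Sym n))

I : ℕ → ℕ → ℕ → ℕ
I n d r = foldr _⊔_ 0
  (map (λ p → interCard n r (proj₁ p) (proj₂ p))
       (filter (λ p → Data.Nat._≟_ (dist (proj₁ p) (proj₂ p)) d)
               (cartesianProduct (Sym n) (Sym n))))

Tc : ∀ {n} → RawPerm n → List (Fin n × Fin n)
Tc {n} π = map (λ i → (i , lookup π i))
               (filter (λ i → ¬? (lookup π i ≟ᶠ i)) (List.allFin n))

module _ {n : ℕ} where
  open DecMem (≡-dec (_≟ᶠ_ {n}) (_≟ᶠ_ {n})) using (_∈?_)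

  TcInter : RawPerm n → RawPerm n → List (Fin n × Fin n)
  TcInter σ π = filter (λ p → p ∈? Tc π) (Tc σ)

{-# OPTIONS --safe #-}
module Submission where

-- The maximum defining I(n, 2r−1, r) is attained at some pair (α, β) of permutations, and
-- left multiplication by β⁻¹ preserves Hamming distance and permutes Sym_n, so it is also
-- attained at the pair (β⁻¹α, I_n); a rotation of 2r−1 points shows that the maximum is over a
-- non-empty set. For the classification, compare i, π(i), σ(i) at each point i: counting unequal
-- pairs gives  d(π,σ) + w(σ) = w(π) + C + 2E,  where C counts the points at which the three are
-- pairwise distinct and E the points fixed by π but moved by σ. With w(π) = 2r−1 and
-- d(π,σ), w(σ) ≤ r this forces E = 0 and C ≤ 1. If C = 0 every move of σ is a move of π, which
-- gives (i) or (ii); if C = 1 then w(σ) = r and all but one of the r moves of σ are moves of π.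

open import Defs
open import Level using (Level)
open import Function using (_∘_; mk⇔)
open import Function.Definitions using (Injective)
open import Data.Bool.Base using (true; false; if_then_else_)
open import Data.Nat
open import Data.Nat.Properties
open import Algebra.Properties.CommutativeSemigroup +-commutativeSemigroup using (interchange)
open import Data.Nat.ListAction using (sum)
open import Data.Nat.ListAction.Properties using (sum-++)
open import Data.Fin as Fin using (Fin; toℕ; fromℕ<; punchOut)
open import Data.Fin.Properties as Finₚ
  using (any?; punchOut-injective; injective⇒≤; toℕ-fromℕ<; toℕ-injective; toℕ<n)
open import Data.Vec as Vec using (Vec; lookup; tabulate)
open import Data.Vec.Properties
  using (∷-injective; lookup-map; lookup∘tabulate; tabulate∘lookup; tabulate-cong; lookup-allFin)
open import Data.List as List using (List; []; _∷_; _∷ʳ_; length; filter; map; upTo; allFin)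
open import Data.List.Properties
  using (filter-≐; filter-some; filter-none; length-map; map-cong; map-++; upTo-∷ʳ; map-tabulate)
import Data.List.Relation.Unary.All as All
open import Data.List.Relation.Unary.All.Properties using (tabulate⁺)
import Data.List.Relation.Unary.AllPairs as AllPairs
open import Data.List.Relation.Unary.Any as Any using (here; there)
open import Data.List.Relation.Unary.Unique.Propositional using (Unique)
import Data.List.Relation.Unary.Unique.Propositional.Properties as Unique
open import Data.List.Membership.Propositional using (_∈_)
open import Data.List.Membership.Propositional.Properties
  using (∈-map⁺; ∈-map⁻; ∈-filter⁺; ∈-filter⁻; ∈-allFin; ∈-cartesianProductWith⁺;
         ∈-cartesianProduct⁺; ∈-cartesianProduct⁻)
open import Data.List.Membership.Propositional.Properties.WithK using (unique∧set⇒bag)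
import Data.List.Membership.DecPropositional as DecMembership
open import Data.List.Relation.Binary.Subset.Propositional using (_⊆_)
open import Data.List.Relation.Binary.BagAndSetEquality using (∼bag⇒↭)
open import Data.List.Relation.Binary.Permutation.Propositional using (_↭_)
open import Data.List.Relation.Binary.Permutation.Propositional.Properties using (↭-length; filter-↭)
open import Data.Product using (Σ; ∃-syntax; _×_; _,_; proj₁; proj₂; uncurry)
open import Data.Product.Properties using (≡-dec)
open import Data.Sum using (_⊎_; inj₁; inj₂)
open import Relation.Nullary using (Dec; yes; no; does; ¬_; ¬?; contradiction)
open import Relation.Nullary.Decidable using (_×-dec_; _⊎-dec_; decidable-stable)
open import Relation.Unary using (Pred; Decidable)
open import Relation.Binary.Definitions using (DecidableEquality; tri<; tri≈; tri>)
open import Relation.Binary.PropositionalEquality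

private variable
  a p q : Level
  A B : Set a
  n : ℕ

-- Counting with indicators

𝟙 : {P : Set p} → Dec P → ℕ
𝟙 P? = if does P? then 1 else 0

sum-map-+ : (f g : A → ℕ) (xs : List A) →
  sum (map (λ x → f x + g x) xs) ≡ sum (map f xs) + sum (map g xs)
sum-map-+ f g [] = refl
sum-map-+ f g (x ∷ xs) = begin
  f x + g x + sum (map (λ x → f x + g x) xs)      ≡⟨ cong (f x + g x +_) (sum-map-+ f g xs) ⟩
  f x + g x + (sum (map f xs) + sum (map g xs))  ≡⟨ interchange (f x) (g x) _ _ ⟩
  f x + sum (map f xs) + (g x + sum (map g xs))  ∎
  where open ≡-Reasoning

sum-map-*ˡ : (k : ℕ) (f : A → ℕ) (xs : List A) → sum (map (λ x → k * f x) xs) ≡ k * sum (map f xs)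
sum-map-*ˡ k f [] = sym (*-zeroʳ k)
sum-map-*ˡ k f (x ∷ xs) =
  trans (cong (k * f x +_) (sum-map-*ˡ k f xs)) (sym (*-distribˡ-+ k (f x) _))

sum-map-upTo-suc : (f : ℕ → ℕ) (r : ℕ) → sum (map f (upTo (suc r))) ≡ sum (map f (upTo r)) + f r
sum-map-upTo-suc f r = begin
  sum (map f (upTo (suc r)))        ≡⟨ cong (sum ∘ map f) (upTo-∷ʳ r) ⟨
  sum (map f (upTo r ∷ʳ r))         ≡⟨ cong sum (map-++ f (upTo r) _) ⟩
  sum (map f (upTo r) ∷ʳ f r)       ≡⟨ sum-++ (map f (upTo r)) _ ⟩
  sum (map f (upTo r)) + (f r + 0)  ≡⟨ cong (sum (map f (upTo r)) +_) (+-identityʳ (f r)) ⟩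
  sum (map f (upTo r)) + f r        ∎
  where open ≡-Reasoning

module _ {P : Pred A p} (P? : Decidable P) where

  length-filter≡sum-𝟙 : (xs : List A) → length (filter P? xs) ≡ sum (map (𝟙 ∘ P?) xs)
  length-filter≡sum-𝟙 [] = refl
  length-filter≡sum-𝟙 (x ∷ xs) with does (P? x)
  ... | true  = cong suc (length-filter≡sum-𝟙 xs)
  ... | false = length-filter≡sum-𝟙 xs

  filter-map : (f : B → A) (xs : List B) → filter P? (map f xs) ≡ map f (filter (P? ∘ f) xs)
  filter-map f [] = refl
  filter-map f (x ∷ xs) with does (P? (f x))
  ... | true  = cong (f x ∷_) (filter-map f xs)
  ... | false = filter-map f xs

  length-filter≡0⇒¬ : {xs : List A} {x : A} → x ∈ xs → length (filter P? xs) ≡ 0 → ¬ P x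
  length-filter≡0⇒¬ x∈xs none Px =
    <⇒≢ (filter-some P? (Any.map (λ x≡y → subst P x≡y Px) x∈xs)) (sym none)

module _ {P : Pred A p} {Q : Pred A q} (P? : Decidable P) (Q? : Decidable Q) where

  length-filter-⊎ : (∀ {x} → P x → ¬ Q x) → (xs : List A) →
    length (filter (λ x → P? x ⊎-dec Q? x) xs) ≡ length (filter P? xs) + length (filter Q? xs)
  length-filter-⊎ disjoint [] = refl
  length-filter-⊎ disjoint (x ∷ xs) with P? x | Q? x
  ... | yes Px | yes Qx = contradiction Qx (disjoint Px)
  ... | yes _  | no _   = cong suc (length-filter-⊎ disjoint xs)
  ... | no _   | yes _  = trans (cong suc (length-filter-⊎ disjoint xs)) (sym (+-suc _ _))
  ... | no _   | no _   = length-filter-⊎ disjoint xs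

  filter-filter : (xs : List A) → filter Q? (filter P? xs) ≡ filter (λ x → P? x ×-dec Q? x) xs
  filter-filter [] = refl
  filter-filter (x ∷ xs) with does (P? x)
  ... | false = filter-filter xs
  ... | true with does (Q? x)
  ...   | true  = cong (x ∷_) (filter-filter xs)
  ...   | false = filter-filter xs

module _ (g : A → ℕ) {Q : Pred A q} (Q? : Decidable Q) (xs : List A) where

  sum-upTo-length-filter-≟ : ∀ r →
    sum (map (λ i → length (filter (λ x → (g x ≟ i) ×-dec Q? x) xs)) (upTo (suc r)))
      ≡ length (filter (λ x → (g x ≤? r) ×-dec Q? x) xs)
  sum-upTo-length-filter-≟ zero =
    trans (+-identityʳ _) (cong length (filter-≐ _ _ (level-zero , zero-level) xs))
    where
    level-zero : ∀ {x} → g x ≡ 0 × Q x → g x ≤ 0 × Q x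
    level-zero (g≡0 , Qx) = ≤-reflexive g≡0 , Qx
    zero-level : ∀ {x} → g x ≤ 0 × Q x → g x ≡ 0 × Q x
    zero-level (g≤0 , Qx) = n≤0⇒n≡0 g≤0 , Qx
  sum-upTo-length-filter-≟ (suc r) = begin
    sum (map level (upTo (suc (suc r))))
      ≡⟨ sum-map-upTo-suc level (suc r) ⟩
    sum (map level (upTo (suc r))) + level (suc r)
      ≡⟨ cong (_+ level (suc r)) (sum-upTo-length-filter-≟ r) ⟩
    length (filter below xs) + level (suc r)
      ≡⟨ length-filter-⊎ below at disjoint xs ⟨
    length (filter (λ x → below x ⊎-dec at x) xs)
      ≡⟨ cong length (filter-≐ _ _ (join , split) xs) ⟩
    length (filter (λ x → (g x ≤? suc r) ×-dec Q? x) xs)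
      ∎
    where
    open ≡-Reasoning
    level : ℕ → ℕ
    level i = length (filter (λ x → (g x ≟ i) ×-dec Q? x) xs)
    below : (x : A) → Dec (g x ≤ r × Q x)
    below x = (g x ≤? r) ×-dec Q? x
    at : (x : A) → Dec (g x ≡ suc r × Q x)
    at x = (g x ≟ suc r) ×-dec Q? x
    disjoint : ∀ {x} → g x ≤ r × Q x → ¬ (g x ≡ suc r × Q x)
    disjoint (g≤r , _) (g≡1+r , _) = ≤⇒≯ g≤r (≤-reflexive (sym g≡1+r))
    join : ∀ {x} → (g x ≤ r × Q x) ⊎ (g x ≡ suc r × Q x) → g x ≤ suc r × Q x
    join (inj₁ (g≤r , Qx)) = m≤n⇒m≤1+n g≤r , Qx
    join (inj₂ (g≡1+r , Qx)) = ≤-reflexive g≡1+r , Qx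
    split : ∀ {x} → g x ≤ suc r × Q x → (g x ≤ r × Q x) ⊎ (g x ≡ suc r × Q x)
    split (g≤1+r , Qx) with m≤n⇒m<n∨m≡n g≤1+r
    ... | inj₁ g<1+r = inj₁ (s≤s⁻¹ g<1+r , Qx)
    ... | inj₂ g≡1+r = inj₂ (g≡1+r , Qx)

foldr-⊔-attained : (h : A → ℕ) {xs : List A} {z : A} → z ∈ xs →
  ∃[ y ] y ∈ xs × List.foldr _⊔_ 0 (map h xs) ≡ h y
foldr-⊔-attained h {x ∷ []} _ = x , here refl , ⊔-identityʳ (h x)
foldr-⊔-attained h {x ∷ x′ ∷ xs} _
  with foldr-⊔-attained h {x′ ∷ xs} (here refl) | ⊔-sel (h x) (List.foldr _⊔_ 0 (map h (x′ ∷ xs)))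
... | _ , _ , _          | inj₁ max≡hx   = x , here refl , max≡hx
... | y , y∈xs , rest≡hy | inj₂ max≡rest = y , there y∈xs , trans max≡rest rest≡hy

n≤2*n∸1 : ∀ n → n ≤ 2 * n ∸ 1
n≤2*n∸1 zero    = z≤n
n≤2*n∸1 (suc k) = subst (_≤ k + (suc k + 0)) (+-identityʳ (suc k)) (m≤n+m (suc k + 0) k)

2*n≤1⇒n≡0 : ∀ n → 2 * n ≤ 1 → n ≡ 0
2*n≤1⇒n≡0 zero    _              = refl
2*n≤1⇒n≡0 (suc k) (s≤s 2k+1≤0) = contradiction (≤-trans (m≤n+m _ k) 2k+1≤0) λ ()

weight-cases : ∀ r {d w c e} → d ≤ r → w ≤ r → d + w ≡ 2 * r ∸ 1 + (c + 2 * e) →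
  e ≡ 0 × (c ≡ 0 × (w ≡ r ∸ 1 ⊎ w ≡ r) ⊎ c ≡ 1 × w ≡ r)
weight-cases zero {c = c} {e} z≤n z≤n 0≡c+2e =
  2*n≤1⇒n≡0 e (≤-trans (≤-reflexive (m+n≡0⇒n≡0 c (sym 0≡c+2e))) z≤n) ,
  inj₁ (m+n≡0⇒m≡0 c (sym 0≡c+2e) , inj₁ refl)
weight-cases (suc k) {d} {w} {c} {e} d≤r w≤r d+w≡ =
  e≡0 , cases c c≤1 (subst (λ x → k + (c + 2 * x) ≤ w) e≡0 lower)
  where
  open ≤-Reasoning
  total : k + suc k + (c + 2 * e) ≡ d + w
  total = trans (cong (λ x → k + x + (c + 2 * e)) (sym (+-identityʳ (suc k)))) (sym d+w≡)
  excess≤1 : c + 2 * e ≤ 1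
  excess≤1 = +-cancelˡ-≤ (k + suc k) _ _ (begin
    k + suc k + (c + 2 * e)  ≡⟨ total ⟩
    d + w                    ≤⟨ +-mono-≤ d≤r w≤r ⟩
    suc k + suc k            ≡⟨ +-comm 1 (k + suc k) ⟩
    k + suc k + 1            ∎)
  e≡0 : e ≡ 0
  e≡0 = 2*n≤1⇒n≡0 e (≤-trans (m≤n+m (2 * e) c) excess≤1)
  c≤1 : c ≤ 1
  c≤1 = ≤-trans (m≤m+n c (2 * e)) excess≤1
  lower : k + (c + 2 * e) ≤ w
  lower = +-cancelʳ-≤ (suc k) _ _ (begin
    k + (c + 2 * e) + suc k    ≡⟨ +-assoc k _ (suc k) ⟩
    k + (c + 2 * e + suc k)    ≡⟨ cong (k +_) (+-comm _ (suc k)) ⟩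
    k + (suc k + (c + 2 * e))  ≡⟨ +-assoc k (suc k) _ ⟨
    k + suc k + (c + 2 * e)    ≡⟨ total ⟩
    d + w                      ≤⟨ +-monoˡ-≤ w d≤r ⟩
    suc k + w                  ≡⟨ +-comm (suc k) w ⟩
    w + suc k                  ∎)
  cases : ∀ c → c ≤ 1 → k + (c + 0) ≤ w → c ≡ 0 × (w ≡ k ⊎ w ≡ suc k) ⊎ c ≡ 1 × w ≡ suc k
  cases 0 _ k+0≤w with m≤n⇒m<n∨m≡n w≤r
  ... | inj₁ w<1+k = inj₁ (refl , inj₁ (≤-antisym (s≤s⁻¹ w<1+k) (subst (_≤ w) (+-identityʳ k) k+0≤w)))
  ... | inj₂ w≡1+k = inj₁ (refl , inj₂ w≡1+k)
  cases 1 _ k+1≤w = inj₂ (refl , ≤-antisym w≤r (subst (_≤ w) (+-comm k 1) k+1≤w))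
  cases (suc (suc _)) (s≤s ()) _

-- Permutations as vectors

lookup-≗⇒≡ : {u v : Vec A n} → (∀ i → lookup u i ≡ lookup v i) → u ≡ v
lookup-≗⇒≡ {u = u} {v} u≗v =
  trans (sym (tabulate∘lookup u)) (trans (tabulate-cong u≗v) (tabulate∘lookup v))

injective⇒surjective : {f : Fin n → Fin n} → Injective _≡_ _≡_ f → ∀ j → ∃[ i ] f i ≡ j
injective⇒surjective {zero} _ ()
injective⇒surjective {suc n} {f} f-inj j with any? (λ i → f i Finₚ.≟ j)
... | yes hit = hit
... | no miss = contradiction (injective⇒≤ punched-injective) 1+n≰n
  where
  j≢f : ∀ i → j ≢ f i
  j≢f i j≡fi = miss (i , sym j≡fi)
  punched-injective : Injective _≡_ _≡_ (λ i → punchOut (j≢f i))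
  punched-injective eq = f-inj (punchOut-injective (j≢f _) (j≢f _) eq)

concatMap≡cartesianProductWith : {C : Set a} (f : A → B → C) (xs : List A) (ys : List B) →
  List.concatMap (λ x → map (f x) ys) xs ≡ List.cartesianProductWith f xs ys
concatMap≡cartesianProductWith f [] ys = refl
concatMap≡cartesianProductWith f (x ∷ xs) ys =
  cong (map (f x) ys List.++_) (concatMap≡cartesianProductWith f xs ys)

allVecs-complete : ∀ m {k} (v : Vec (Fin m) k) → v ∈ allVecs m k
allVecs-complete m Vec.[] = here refl
allVecs-complete m {suc k} (x Vec.∷ v) =
  subst (_ ∈_) (sym (concatMap≡cartesianProductWith Vec._∷_ (allFin m) (allVecs m k)))
    (∈-cartesianProductWith⁺ Vec._∷_ (∈-allFin x) (allVecs-complete m v))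

allVecs-unique : ∀ m k → Unique (allVecs m k)
allVecs-unique m zero = All.[] AllPairs.∷ AllPairs.[]
allVecs-unique m (suc k) =
  subst Unique (sym (concatMap≡cartesianProductWith Vec._∷_ (allFin m) (allVecs m k)))
    (Unique.cartesianProductWith⁺ Vec._∷_ ∷-injective (Unique.allFin⁺ m) (allVecs-unique m k))

Sym-unique : ∀ n → Unique (Sym n)
Sym-unique n = Unique.filter⁺ isPerm? (allVecs-unique n n)

∈-Sym⁺ : (σ : RawPerm n) → IsPerm σ → σ ∈ Sym n
∈-Sym⁺ {n} σ σ-perm = ∈-filter⁺ isPerm? (allVecs-complete n σ) σ-perm

∈-Sym⁻ : {σ : RawPerm n} → σ ∈ Sym n → IsPerm σ
∈-Sym⁻ {n} σ∈Sym = proj₂ (∈-filter⁻ isPerm? {xs = allVecs n n} σ∈Sym)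

infixr 9 _∘ₚ_

_∘ₚ_ : RawPerm n → RawPerm n → RawPerm n
β ∘ₚ σ = Vec.map (lookup β) σ

lookup-∘ₚ : (β σ : RawPerm n) (i : Fin n) → lookup (β ∘ₚ σ) i ≡ lookup β (lookup σ i)
lookup-∘ₚ β σ i = lookup-map i (lookup β) σ

∘ₚ-isPerm : (β σ : RawPerm n) → IsPerm β → IsPerm σ → IsPerm (β ∘ₚ σ)
∘ₚ-isPerm β σ β-perm σ-perm i j eq =
  σ-perm i j (β-perm _ _ (trans (sym (lookup-∘ₚ β σ i)) (trans eq (lookup-∘ₚ β σ j))))

idPerm-isPerm : IsPerm (idPerm n)
idPerm-isPerm i j eq = trans (sym (lookup-allFin i)) (trans eq (lookup-allFin j))

∘ₚ-identityʳ : (β : RawPerm n) → β ∘ₚ idPerm n ≡ β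
∘ₚ-identityʳ {n} β = lookup-≗⇒≡ λ i →
  trans (lookup-∘ₚ β (idPerm n) i) (cong (lookup β) (lookup-allFin i))

dist-sym : (π τ : RawPerm n) → dist π τ ≡ dist τ π
dist-sym π τ = cong length (filter-≐ (λ i → ¬? (lookup π i Finₚ.≟ lookup τ i))
                                    (λ i → ¬? (lookup τ i Finₚ.≟ lookup π i))
                                    ((_∘ sym) , (_∘ sym)) (allFin _))

module _ (β : RawPerm n) (β-perm : IsPerm β) where

  inverse : RawPerm n
  inverse = tabulate (λ j → proj₁ (injective⇒surjective (β-perm _ _) j))

  lookup-inverseʳ : ∀ j → lookup β (lookup inverse j) ≡ j
  lookup-inverseʳ j = trans (cong (lookup β) (lookup∘tabulate _ j))
                            (proj₂ (injective⇒surjective (β-perm _ _) j))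

  inverse-isPerm : IsPerm inverse
  inverse-isPerm i j eq =
    trans (sym (lookup-inverseʳ i)) (trans (cong (lookup β) eq) (lookup-inverseʳ j))

  ∘ₚ-inverseʳ : (σ : RawPerm n) → β ∘ₚ inverse ∘ₚ σ ≡ σ
  ∘ₚ-inverseʳ σ = lookup-≗⇒≡ λ i → begin
    lookup (β ∘ₚ inverse ∘ₚ σ) i            ≡⟨ lookup-∘ₚ β (inverse ∘ₚ σ) i ⟩
    lookup β (lookup (inverse ∘ₚ σ) i)      ≡⟨ cong (lookup β) (lookup-∘ₚ inverse σ i) ⟩
    lookup β (lookup inverse (lookup σ i))  ≡⟨ lookup-inverseʳ (lookup σ i) ⟩
    lookup σ i                              ∎
    where open ≡-Reasoning

  ∘ₚ-cancelˡ-at : (π σ : RawPerm n) (i : Fin n) →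
    lookup (β ∘ₚ π) i ≡ lookup (β ∘ₚ σ) i → lookup π i ≡ lookup σ i
  ∘ₚ-cancelˡ-at π σ i eq =
    β-perm _ _ (trans (sym (lookup-∘ₚ β π i)) (trans eq (lookup-∘ₚ β σ i)))

  ∘ₚ-injective : Injective _≡_ _≡_ (β ∘ₚ_)
  ∘ₚ-injective {π} {σ} eq = lookup-≗⇒≡ λ i → ∘ₚ-cancelˡ-at π σ i (cong (λ v → lookup v i) eq)

  dist-∘ₚ : (π σ : RawPerm n) → dist (β ∘ₚ π) (β ∘ₚ σ) ≡ dist π σ
  dist-∘ₚ π σ = cong length (filter-≐ (λ i → ¬? (lookup (β ∘ₚ π) i Finₚ.≟ lookup (β ∘ₚ σ) i))
                                     (λ i → ¬? (lookup π i Finₚ.≟ lookup σ i))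
                                     (_∘ ∘ₚ-congˡ-at , _∘ ∘ₚ-cancelˡ-at π σ _) (allFin _))
    where
    ∘ₚ-congˡ-at : ∀ {i} → lookup π i ≡ lookup σ i → lookup (β ∘ₚ π) i ≡ lookup (β ∘ₚ σ) i
    ∘ₚ-congˡ-at {i} eq = trans (lookup-∘ₚ β π i) (trans (cong (lookup β) eq) (sym (lookup-∘ₚ β σ i)))

  map-∘ₚ-Sym↭Sym : map (β ∘ₚ_) (Sym n) ↭ Sym n
  map-∘ₚ-Sym↭Sym =
    ∼bag⇒↭ (unique∧set⇒bag (Unique.map⁺ ∘ₚ-injective (Sym-unique n)) (Sym-unique n) (mk⇔ to from))
    where
    to : ∀ {σ} → σ ∈ map (β ∘ₚ_) (Sym n) → σ ∈ Sym n
    to σ∈ with ∈-map⁻ (β ∘ₚ_) σ∈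
    ... | τ , τ∈Sym , refl = ∈-Sym⁺ (β ∘ₚ τ) (∘ₚ-isPerm β τ β-perm (∈-Sym⁻ τ∈Sym))
    from : ∀ {σ} → σ ∈ Sym n → σ ∈ map (β ∘ₚ_) (Sym n)
    from {σ} σ∈Sym = subst (_∈ _) (∘ₚ-inverseʳ σ) (∈-map⁺ (β ∘ₚ_)
      (∈-Sym⁺ (inverse ∘ₚ σ) (∘ₚ-isPerm inverse σ inverse-isPerm (∈-Sym⁻ σ∈Sym))))

  length-filter-Sym-∘ₚ : {P : Pred (RawPerm n) p} (P? : Decidable P) →
    length (filter (P? ∘ (β ∘ₚ_)) (Sym n)) ≡ length (filter P? (Sym n))
  length-filter-Sym-∘ₚ P? = begin
    length (filter (P? ∘ (β ∘ₚ_)) (Sym n))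
      ≡⟨ length-map (β ∘ₚ_) (filter (P? ∘ (β ∘ₚ_)) (Sym n)) ⟨
    length (map (β ∘ₚ_) (filter (P? ∘ (β ∘ₚ_)) (Sym n)))
      ≡⟨ cong length (filter-map P? (β ∘ₚ_) (Sym n)) ⟨
    length (filter P? (map (β ∘ₚ_) (Sym n)))
      ≡⟨ ↭-length (filter-↭ P? map-∘ₚ-Sym↭Sym) ⟩
    length (filter P? (Sym n))
      ∎
    where open ≡-Reasoning

  interCard-∘ₚ : ∀ r (π τ : RawPerm n) → interCard n r (β ∘ₚ π) (β ∘ₚ τ) ≡ interCard n r π τ
  interCard-∘ₚ r π τ = begin
    interCard n r (β ∘ₚ π) (β ∘ₚ τ)
      ≡⟨ length-filter-Sym-∘ₚ (λ σ → near (β ∘ₚ π) σ ×-dec near (β ∘ₚ τ) σ) ⟨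
    length (filter (λ σ → near (β ∘ₚ π) (β ∘ₚ σ) ×-dec near (β ∘ₚ τ) (β ∘ₚ σ)) (Sym n))
      ≡⟨ cong length (filter-≐ (λ σ → near (β ∘ₚ π) (β ∘ₚ σ) ×-dec near (β ∘ₚ τ) (β ∘ₚ σ))
                               (λ σ → near π σ ×-dec near τ σ)
                               ((λ {σ} → cancel σ) , (λ {σ} → uncancel σ)) (Sym n)) ⟩
    interCard n r π τ
      ∎
    where
    open ≡-Reasoning
    near : (ρ σ : RawPerm n) → Dec (dist ρ σ ≤ r)
    near ρ σ = dist ρ σ ≤? r
    cancel : ∀ σ → dist (β ∘ₚ π) (β ∘ₚ σ) ≤ r × dist (β ∘ₚ τ) (β ∘ₚ σ) ≤ r →
             dist π σ ≤ r × dist τ σ ≤ r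
    cancel σ (π≤ , τ≤) = subst (_≤ r) (dist-∘ₚ π σ) π≤ , subst (_≤ r) (dist-∘ₚ τ σ) τ≤
    uncancel : ∀ σ → dist π σ ≤ r × dist τ σ ≤ r →
               dist (β ∘ₚ π) (β ∘ₚ σ) ≤ r × dist (β ∘ₚ τ) (β ∘ₚ σ) ≤ r
    uncancel σ (π≤ , τ≤) = subst (_≤ r) (sym (dist-∘ₚ π σ)) π≤ , subst (_≤ r) (sym (dist-∘ₚ τ σ)) τ≤

  wH-inverse-∘ₚ : (α : RawPerm n) → wH (inverse ∘ₚ α) ≡ dist α β
  wH-inverse-∘ₚ α = begin
    dist (idPerm n) (inverse ∘ₚ α)               ≡⟨ dist-∘ₚ (idPerm n) (inverse ∘ₚ α) ⟨
    dist (β ∘ₚ idPerm n) (β ∘ₚ inverse ∘ₚ α)     ≡⟨ cong₂ dist (∘ₚ-identityʳ β) (∘ₚ-inverseʳ α) ⟩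
    dist β α                                     ≡⟨ dist-sym β α ⟩
    dist α β                                     ∎
    where open ≡-Reasoning

  interCard-inverse-∘ₚ : ∀ r (α : RawPerm n) →
    interCard n r α β ≡ interCard n r (inverse ∘ₚ α) (idPerm n)
  interCard-inverse-∘ₚ r α = begin
    interCard n r α β
      ≡⟨ cong₂ (interCard n r) (∘ₚ-inverseʳ α) (∘ₚ-identityʳ β) ⟨
    interCard n r (β ∘ₚ inverse ∘ₚ α) (β ∘ₚ idPerm n)
      ≡⟨ interCard-∘ₚ r (inverse ∘ₚ α) (idPerm n) ⟩
    interCard n r (inverse ∘ₚ α) (idPerm n)
      ∎
    where open ≡-Reasoning

I-attained : ∀ d r (π₀ τ₀ : RawPerm n) → IsPerm π₀ → IsPerm τ₀ → dist π₀ τ₀ ≡ d →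
  ∃[ α ] ∃[ β ] IsPerm α × IsPerm β × dist α β ≡ d × I n d r ≡ interCard n r α β
I-attained {n} d r π₀ τ₀ π₀-perm τ₀-perm d₀
  with foldr-⊔-attained (uncurry (interCard n r))
         (∈-filter⁺ (λ p → dist (proj₁ p) (proj₂ p) ≟ d)
                    (∈-cartesianProduct⁺ (∈-Sym⁺ π₀ π₀-perm) (∈-Sym⁺ τ₀ τ₀-perm)) d₀)
... | (α , β) , αβ∈ , I≡ with ∈-filter⁻ (λ p → dist (proj₁ p) (proj₂ p) ≟ d) αβ∈
... | αβ∈Sym² , dαβ with ∈-cartesianProduct⁻ (Sym n) (Sym n) αβ∈Sym²
... | α∈ , β∈ = α , β , ∈-Sym⁻ α∈ , ∈-Sym⁻ β∈ , dαβ , I≡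

I-attained-at-idPerm : ∀ d r (π₀ τ₀ : RawPerm n) → IsPerm π₀ → IsPerm τ₀ → dist π₀ τ₀ ≡ d →
  Σ (RawPerm n) λ π → IsPerm π × wH π ≡ d × I n d r ≡ interCard n r π (idPerm n)
I-attained-at-idPerm d r π₀ τ₀ π₀-perm τ₀-perm d₀ =
  let α , β , α-perm , β-perm , dαβ≡d , I≡ = I-attained d r π₀ τ₀ π₀-perm τ₀-perm d₀ in
  inverse β β-perm ∘ₚ α ,
  ∘ₚ-isPerm (inverse β β-perm) α (inverse-isPerm β β-perm) α-perm ,
  trans (wH-inverse-∘ₚ β β-perm α) dαβ≡d ,
  trans I≡ (interCard-inverse-∘ₚ β β-perm r α)

-- A permutation with m moved points

rotate : ℕ → ℕ → ℕ
rotate m k with <-cmp (suc k) m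
... | tri< _ _ _ = suc k
... | tri≈ _ _ _ = 0
... | tri> _ _ _ = k

rotate-< : ∀ {m k} → m ≤ n → k < n → rotate m k < n
rotate-< {m = m} {k} m≤n k<n with <-cmp (suc k) m
... | tri< 1+k<m _ _ = <-≤-trans 1+k<m m≤n
... | tri≈ _ _ _     = ≤-<-trans z≤n k<n
... | tri> _ _ _     = k<n

rotate-injective : ∀ m {j k} → rotate m j ≡ rotate m k → j ≡ k
rotate-injective m {j} {k} eq with <-cmp (suc j) m | <-cmp (suc k) m
rotate-injective m refl | tri< _ _ _     | tri< _ _ _     = refl
rotate-injective m ()   | tri< _ _ _     | tri≈ _ _ _
rotate-injective m refl | tri< 1+j<m _ _ | tri> _ _ m<2+j = contradiction (s≤s⁻¹ m<2+j) (<⇒≱ 1+j<m)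
rotate-injective m ()   | tri≈ _ _ _     | tri< _ _ _
rotate-injective m _    | tri≈ _ 1+j≡m _ | tri≈ _ 1+k≡m _ = suc-injective (trans 1+j≡m (sym 1+k≡m))
rotate-injective m refl | tri≈ _ refl _  | tri> _ _ (s≤s ())
rotate-injective m refl | tri> _ _ m<2+k | tri< 1+k<m _ _ = contradiction (s≤s⁻¹ m<2+k) (<⇒≱ 1+k<m)
rotate-injective m refl | tri> _ _ (s≤s ()) | tri≈ _ refl _
rotate-injective m eq   | tri> _ _ _     | tri> _ _ _     = eq

rotate-fixes : ∀ {m k} → m ≤ k → rotate m k ≡ k
rotate-fixes {m} {k} m≤k with <-cmp (suc k) m
... | tri< 1+k<m _ _ = contradiction m≤k (<⇒≱ (<-trans (n<1+n k) 1+k<m))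
... | tri≈ _ 1+k≡m _ = contradiction (subst (_≤ k) (sym 1+k≡m) m≤k) 1+n≰n
... | tri> _ _ _     = refl

rotate-moves : ∀ {m k} → 2 ≤ m → k < m → rotate m k ≢ k
rotate-moves {m} {k} 2≤m k<m with <-cmp (suc k) m
... | tri< _ _ _        = 1+n≢n
... | tri≈ _ 1+k≡m _    = λ 0≡k → <⇒≱ (subst (2 ≤_) (sym 1+k≡m) 2≤m) (s≤s (≤-reflexive (sym 0≡k)))
... | tri> _ _ m<1+k    = λ _ → <⇒≱ k<m (s≤s⁻¹ m<1+k)

length-filter-toℕ<-allFin : ∀ {m n} → m ≤ n → length (filter (λ i → toℕ i <? m) (allFin n)) ≡ m
length-filter-toℕ<-allFin {zero} {n} _ =
  cong length (filter-none (λ i → toℕ i <? 0) (tabulate⁺ {n = n} {f = λ i → i} (λ _ ())))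
length-filter-toℕ<-allFin {suc m} {suc n} (s≤s m≤n) = cong suc (begin
  length (filter (λ i → toℕ i <? suc m) (List.tabulate {n = n} Fin.suc))
    ≡⟨ cong (length ∘ filter (λ i → toℕ i <? suc m)) (map-tabulate {n = n} (λ i → i) Fin.suc) ⟨
  length (filter (λ i → toℕ i <? suc m) (map Fin.suc (allFin n)))
    ≡⟨ cong length (filter-map (λ i → toℕ i <? suc m) Fin.suc (allFin n)) ⟩
  length (map Fin.suc (filter (λ i → suc (toℕ i) <? suc m) (allFin n)))
    ≡⟨ length-map Fin.suc (filter (λ i → suc (toℕ i) <? suc m) (allFin n)) ⟩
  length (filter (λ i → suc (toℕ i) <? suc m) (allFin n))
    ≡⟨ cong length (filter-≐ (λ i → suc (toℕ i) <? suc m) (λ i → toℕ i <? m)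
                             (s≤s⁻¹ , s≤s) (allFin n)) ⟩
  length (filter (λ i → toℕ i <? m) (allFin n))
    ≡⟨ length-filter-toℕ<-allFin m≤n ⟩
  m ∎)
  where open ≡-Reasoning

module _ {n m : ℕ} (m≤n : m ≤ n) where

  rotation : RawPerm n
  rotation = tabulate (λ i → fromℕ< (rotate-< m≤n (toℕ<n i)))

  toℕ-lookup-rotation : ∀ i → toℕ (lookup rotation i) ≡ rotate m (toℕ i)
  toℕ-lookup-rotation i = trans (cong toℕ (lookup∘tabulate _ i)) (toℕ-fromℕ< _)

  rotation-isPerm : IsPerm rotation
  rotation-isPerm i j eq = toℕ-injective (rotate-injective m
    (trans (sym (toℕ-lookup-rotation i)) (trans (cong toℕ eq) (toℕ-lookup-rotation j))))

  wH-rotation : 2 ≤ m → wH rotation ≡ m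
  wH-rotation 2≤m = trans
    (cong length (filter-≐ (λ i → ¬? (lookup (idPerm n) i Finₚ.≟ lookup rotation i))
                           (λ i → toℕ i <? m) (moved⇒< , <⇒moved) (allFin n)))
    (length-filter-toℕ<-allFin m≤n)
    where
    moved⇒< : ∀ {i} → lookup (idPerm n) i ≢ lookup rotation i → toℕ i < m
    moved⇒< {i} moved = ≰⇒> λ m≤i → moved (trans (lookup-allFin i) (toℕ-injective
      (sym (trans (toℕ-lookup-rotation i) (rotate-fixes m≤i)))))
    <⇒moved : ∀ {i} → toℕ i < m → lookup (idPerm n) i ≢ lookup rotation i
    <⇒moved {i} i<m fixed = rotate-moves 2≤m i<m
      (trans (sym (toℕ-lookup-rotation i)) (cong toℕ (trans (sym fixed) (lookup-allFin i))))

-- Comparing σ with π pointwise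

module _ {A : Set a} (_≟_ : DecidableEquality A) where

  distinct? : (u v w : A) → Dec (u ≢ v × u ≢ w × v ≢ w)
  distinct? u v w = ¬? (u ≟ v) ×-dec ¬? (u ≟ w) ×-dec ¬? (v ≟ w)

  𝟙-triangle : ∀ u v w → 𝟙 (¬? (v ≟ w)) + 𝟙 (¬? (u ≟ w))
                       ≡ 𝟙 (¬? (u ≟ v)) + (𝟙 (distinct? u v w) + 2 * 𝟙 (u ≟ v ×-dec ¬? (u ≟ w)))
  𝟙-triangle u v w with u ≟ v | u ≟ w | v ≟ w
  ... | yes _   | yes _   | yes _   = refl
  ... | yes u≡v | yes u≡w | no v≢w  = contradiction (trans (sym u≡v) u≡w) v≢w
  ... | yes u≡v | no u≢w  | yes v≡w = contradiction (trans u≡v v≡w) u≢w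
  ... | yes _   | no _    | no _    = refl
  ... | no u≢v  | yes u≡w | yes v≡w = contradiction (trans u≡w (sym v≡w)) u≢v
  ... | no _    | yes _   | no _    = refl
  ... | no _    | no _    | yes _   = refl
  ... | no _    | no _    | no _    = refl

  𝟙-moved-split : ∀ u v w → 𝟙 (¬? (u ≟ w))
                    ≡ 𝟙 (¬? (u ≟ w) ×-dec v ≟ w) + (𝟙 (distinct? u v w) + 𝟙 (u ≟ v ×-dec ¬? (u ≟ w)))
  𝟙-moved-split u v w with u ≟ v | u ≟ w | v ≟ w
  ... | yes _   | yes _   | yes _   = refl
  ... | yes u≡v | yes u≡w | no v≢w  = contradiction (trans (sym u≡v) u≡w) v≢w
  ... | yes u≡v | no u≢w  | yes v≡w = contradiction (trans u≡v v≡w) u≢w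
  ... | yes _   | no _    | no _    = refl
  ... | no u≢v  | yes u≡w | yes v≡w = contradiction (trans u≡w (sym v≡w)) u≢v
  ... | no _    | yes _   | no _    = refl
  ... | no _    | no _    | yes _   = refl
  ... | no _    | no _    | no _    = refl

#[_] : {P : Pred (Fin n) p} → Decidable P → ℕ
#[ P? ] = length (filter P? (allFin _))

∈-Tc⁺ : (τ : RawPerm n) {j : Fin n} → lookup τ j ≢ j → (j , lookup τ j) ∈ Tc τ
∈-Tc⁺ τ {j} τj≢j = ∈-map⁺ _ (∈-filter⁺ (λ i → ¬? (lookup τ i Finₚ.≟ i)) (∈-allFin j) τj≢j)

∈-Tc⁻ : (τ : RawPerm n) {j k : Fin n} → (j , k) ∈ Tc τ → lookup τ j ≢ j × k ≡ lookup τ j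
∈-Tc⁻ {n} τ jk∈ with ∈-map⁻ (λ i → (i , lookup τ i)) jk∈
... | i , i∈ , refl = proj₂ (∈-filter⁻ (λ i → ¬? (lookup τ i Finₚ.≟ i)) {xs = allFin n} i∈) , refl

≢-idPerm : {i x : Fin n} → x ≢ i → lookup (idPerm n) i ≢ x
≢-idPerm {i = i} x≢i ι≡x = x≢i (trans (sym ι≡x) (lookup-allFin i))

idPerm-≢ : {i x : Fin n} → lookup (idPerm n) i ≢ x → x ≢ i
idPerm-≢ {i = i} ι≢x x≡i = ι≢x (trans (lookup-allFin i) (sym x≡i))

length-Tc : (τ : RawPerm n) → length (Tc τ) ≡ wH τ
length-Tc {n} τ = trans (length-map _ (filter (λ i → ¬? (lookup τ i Finₚ.≟ i)) (allFin n)))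
  (cong length (filter-≐ (λ i → ¬? (lookup τ i Finₚ.≟ i))
                         (λ i → ¬? (lookup (idPerm n) i Finₚ.≟ lookup τ i))
                         (≢-idPerm , idPerm-≢) (allFin n)))

module Comparison (π σ : RawPerm n) where

  -- ι i is i, written through idPerm so that counting the i with ι i ≢ τ i is wH τ by definition.
  private
    ι π′ σ′ : Fin n → Fin n
    ι = lookup (idPerm n)
    π′ = lookup π
    σ′ = lookup σ

  -- A point moved by σ is of exactly one kind: σ repeats the move of π there (an entry of
  -- Tc σ ∩ Tc π), both move it to different places, or π fixes it.
  shared? : (i : Fin n) → Dec (ι i ≢ σ′ i × π′ i ≡ σ′ i)
  strayed? : (i : Fin n) → Dec (ι i ≢ π′ i × ι i ≢ σ′ i × π′ i ≢ σ′ i)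
  fresh? : (i : Fin n) → Dec (ι i ≡ π′ i × ι i ≢ σ′ i)
  shared?  i = ¬? (ι i Finₚ.≟ σ′ i) ×-dec π′ i Finₚ.≟ σ′ i
  strayed? i = distinct? Finₚ._≟_ (ι i) (π′ i) (σ′ i)
  fresh?   i = ι i Finₚ.≟ π′ i ×-dec ¬? (ι i Finₚ.≟ σ′ i)

  private
    Σᵢ : (Fin n → ℕ) → ℕ
    Σᵢ f = sum (map f (allFin n))

    #≡Σᵢ : {P : Pred (Fin n) p} (P? : Decidable P) → #[ P? ] ≡ Σᵢ (𝟙 ∘ P?)
    #≡Σᵢ P? = length-filter≡sum-𝟙 P? (allFin n)

    moved? : (τ : RawPerm n) (i : Fin n) → Dec (ι i ≢ lookup τ i)
    moved? τ i = ¬? (ι i Finₚ.≟ lookup τ i)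

  dist+wH≡wH+strayed+fresh : dist π σ + wH σ ≡ wH π + (#[ strayed? ] + 2 * #[ fresh? ])
  dist+wH≡wH+strayed+fresh = begin
    dist π σ + wH σ
      ≡⟨ cong₂ _+_ (#≡Σᵢ (λ i → ¬? (π′ i Finₚ.≟ σ′ i))) (#≡Σᵢ (moved? σ)) ⟩
    Σᵢ (λ i → 𝟙 (¬? (π′ i Finₚ.≟ σ′ i))) + Σᵢ (𝟙 ∘ moved? σ)
      ≡⟨ sum-map-+ _ _ (allFin n) ⟨
    Σᵢ (λ i → 𝟙 (¬? (π′ i Finₚ.≟ σ′ i)) + 𝟙 (moved? σ i))
      ≡⟨ cong sum (map-cong (λ i → 𝟙-triangle Finₚ._≟_ (ι i) (π′ i) (σ′ i)) (allFin n)) ⟩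
    Σᵢ (λ i → 𝟙 (moved? π i) + (𝟙 (strayed? i) + 2 * 𝟙 (fresh? i)))
      ≡⟨ sum-map-+ _ _ (allFin n) ⟩
    Σᵢ (𝟙 ∘ moved? π) + Σᵢ (λ i → 𝟙 (strayed? i) + 2 * 𝟙 (fresh? i))
      ≡⟨ cong (Σᵢ (𝟙 ∘ moved? π) +_) (sum-map-+ _ _ (allFin n)) ⟩
    Σᵢ (𝟙 ∘ moved? π) + (Σᵢ (𝟙 ∘ strayed?) + Σᵢ (λ i → 2 * 𝟙 (fresh? i)))
      ≡⟨ cong (λ x → Σᵢ (𝟙 ∘ moved? π) + (Σᵢ (𝟙 ∘ strayed?) + x)) (sum-map-*ˡ 2 _ (allFin n)) ⟩
    Σᵢ (𝟙 ∘ moved? π) + (Σᵢ (𝟙 ∘ strayed?) + 2 * Σᵢ (𝟙 ∘ fresh?))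
      ≡⟨ cong₂ _+_ (#≡Σᵢ (moved? π)) (cong₂ _+_ (#≡Σᵢ strayed?) (cong (2 *_) (#≡Σᵢ fresh?))) ⟨
    wH π + (#[ strayed? ] + 2 * #[ fresh? ])
      ∎
    where open ≡-Reasoning

  wH≡shared+strayed+fresh : wH σ ≡ #[ shared? ] + (#[ strayed? ] + #[ fresh? ])
  wH≡shared+strayed+fresh = begin
    wH σ
      ≡⟨ #≡Σᵢ (moved? σ) ⟩
    Σᵢ (𝟙 ∘ moved? σ)
      ≡⟨ cong sum (map-cong (λ i → 𝟙-moved-split Finₚ._≟_ (ι i) (π′ i) (σ′ i)) (allFin n)) ⟩
    Σᵢ (λ i → 𝟙 (shared? i) + (𝟙 (strayed? i) + 𝟙 (fresh? i)))
      ≡⟨ trans (sum-map-+ _ _ (allFin n)) (cong (Σᵢ (𝟙 ∘ shared?) +_) (sum-map-+ _ _ (allFin n))) ⟩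
    Σᵢ (𝟙 ∘ shared?) + (Σᵢ (𝟙 ∘ strayed?) + Σᵢ (𝟙 ∘ fresh?))
      ≡⟨ cong₂ _+_ (#≡Σᵢ shared?) (cong₂ _+_ (#≡Σᵢ strayed?) (#≡Σᵢ fresh?)) ⟨
    #[ shared? ] + (#[ strayed? ] + #[ fresh? ])
      ∎
    where open ≡-Reasoning

  open DecMembership (≡-dec (Finₚ._≟_ {n}) (Finₚ._≟_ {n})) using (_∈?_)

  length-TcInter : length (TcInter σ π) ≡ #[ shared? ]
  length-TcInter = begin
    length (TcInter σ π)
      ≡⟨ cong length (filter-map (_∈? Tc π) graph (filter σ-moves? (allFin n))) ⟩
    length (map graph (filter (λ i → graph i ∈? Tc π) (filter σ-moves? (allFin n))))
      ≡⟨ length-map graph (filter (λ i → graph i ∈? Tc π) (filter σ-moves? (allFin n))) ⟩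
    length (filter (λ i → graph i ∈? Tc π) (filter σ-moves? (allFin n)))
      ≡⟨ cong length (filter-filter σ-moves? (λ i → graph i ∈? Tc π) (allFin n)) ⟩
    length (filter (λ i → σ-moves? i ×-dec graph i ∈? Tc π) (allFin n))
      ≡⟨ cong length (filter-≐ (λ i → σ-moves? i ×-dec graph i ∈? Tc π) shared?
                               (to , from) (allFin n)) ⟩
    #[ shared? ]
      ∎
    where
    open ≡-Reasoning
    graph : Fin n → Fin n × Fin n
    graph i = i , σ′ i
    σ-moves? : (i : Fin n) → Dec (σ′ i ≢ i)
    σ-moves? i = ¬? (σ′ i Finₚ.≟ i)
    to : ∀ {i} → σ′ i ≢ i × graph i ∈ Tc π → ι i ≢ σ′ i × π′ i ≡ σ′ i
    to (σi≢i , i↦σi∈Tcπ) = ≢-idPerm σi≢i , sym (proj₂ (∈-Tc⁻ π i↦σi∈Tcπ))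
    from : ∀ {i} → ι i ≢ σ′ i × π′ i ≡ σ′ i → σ′ i ≢ i × graph i ∈ Tc π
    from {i} (ι≢σ , π≡σ) = idPerm-≢ ι≢σ ,
      subst (λ k → (i , k) ∈ Tc π) π≡σ (∈-Tc⁺ π (λ πi≡i → idPerm-≢ ι≢σ (trans (sym π≡σ) πi≡i)))

  Tc-⊆ : #[ strayed? ] ≡ 0 → #[ fresh? ] ≡ 0 → Tc σ ⊆ Tc π
  Tc-⊆ no-strayed no-fresh {j , k} jk∈Tcσ with ∈-Tc⁻ σ jk∈Tcσ
  ... | σj≢j , refl = subst (λ k → (j , k) ∈ Tc π) π≡σ (∈-Tc⁺ π (idPerm-≢ ι≢π))
    where
    ι≢σ : ι j ≢ σ′ j
    ι≢σ = ≢-idPerm σj≢j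
    ι≢π : ι j ≢ π′ j
    ι≢π ι≡π = length-filter≡0⇒¬ fresh? (∈-allFin j) no-fresh (ι≡π , ι≢σ)
    π≡σ : π′ j ≡ σ′ j
    π≡σ = decidable-stable (π′ j Finₚ.≟ σ′ j)
      λ π≢σ → length-filter≡0⇒¬ strayed? (∈-allFin j) no-strayed (ι≢π , ι≢σ , π≢σ)

  length-TcInter≡wH∸1 : #[ strayed? ] ≡ 1 → #[ fresh? ] ≡ 0 → length (TcInter σ π) ≡ wH σ ∸ 1
  length-TcInter≡wH∸1 one-strayed no-fresh = begin
    length (TcInter σ π)
      ≡⟨ length-TcInter ⟩
    #[ shared? ]
      ≡⟨ m+n∸n≡m #[ shared? ] 1 ⟨
    #[ shared? ] + 1 ∸ 1
      ≡⟨ cong (λ x → #[ shared? ] + x ∸ 1) (cong₂ _+_ one-strayed no-fresh) ⟨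
    #[ shared? ] + (#[ strayed? ] + #[ fresh? ]) ∸ 1
      ≡⟨ cong (_∸ 1) wH≡shared+strayed+fresh ⟨
    wH σ ∸ 1
      ∎
    where open ≡-Reasoning

  Tc-classification : ∀ r → wH π ≡ 2 * r ∸ 1 → dist π σ ≤ r → wH σ ≤ r →
    ((Tc σ ⊆ Tc π) × length (Tc σ) ≡ r ∸ 1)
    ⊎ ((Tc σ ⊆ Tc π) × length (Tc σ) ≡ r)
    ⊎ (length (TcInter σ π) ≡ r ∸ 1 × length (Tc σ) ≡ r)
  Tc-classification r wHπ≡ d≤r w≤r
    with weight-cases r d≤r w≤r
           (trans dist+wH≡wH+strayed+fresh (cong (_+ (#[ strayed? ] + 2 * #[ fresh? ])) wHπ≡))
  ... | no-fresh , inj₁ (no-strayed , inj₁ w≡r∸1) =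
    inj₁ (Tc-⊆ no-strayed no-fresh , trans (length-Tc σ) w≡r∸1)
  ... | no-fresh , inj₁ (no-strayed , inj₂ w≡r) =
    inj₂ (inj₁ (Tc-⊆ no-strayed no-fresh , trans (length-Tc σ) w≡r))
  ... | no-fresh , inj₂ (one-strayed , w≡r) =
    inj₂ (inj₂ (trans (length-TcInter≡wH∸1 one-strayed no-fresh) (cong (_∸ 1) w≡r) ,
                trans (length-Tc σ) w≡r))

interCard-idPerm≡sum-levels : ∀ r (π : RawPerm n) →
  interCard n r π (idPerm n)
    ≡ sum (map (λ i → length (filter (λ σ → (wH σ ≟ i) ×-dec (dist σ π ≤? r)) (Sym n)))
               (upTo (suc r)))
interCard-idPerm≡sum-levels {n} r π = trans
  (cong length (filter-≐ (λ σ → (dist π σ ≤? r) ×-dec (wH σ ≤? r))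
                         (λ σ → (wH σ ≤? r) ×-dec (dist σ π ≤? r))
                         ((λ {σ} (d≤r , w≤r) → w≤r , subst (_≤ r) (dist-sym π σ) d≤r) ,
                          (λ {σ} (w≤r , d≤r) → subst (_≤ r) (dist-sym σ π) d≤r , w≤r)) (Sym n)))
  (sym (sum-upTo-length-filter-≟ wH (λ σ → dist σ π ≤? r) (Sym n) r))

lemma10 : (n r : ℕ) → 2 ≤ r → 2 * r ∸ 1 ≤ n →
    Σ (RawPerm n) λ π →
      IsPerm π
      × wH π ≡ 2 * r ∸ 1
      × I n (2 * r ∸ 1) r ≡ interCard n r π (idPerm n)
      × interCard n r π (idPerm n)
          ≡ sum (map (λ i → length (filter (λ σ → (wH σ ≟ i) ×-dec (dist σ π ≤? r)) (Sym n)))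
                     (upTo (suc r)))
      × ((σ : RawPerm n) → IsPerm σ → dist π σ ≤ r → dist (idPerm n) σ ≤ r →
          ((Tc σ ⊆ Tc π) × length (Tc σ) ≡ r ∸ 1)
          ⊎ ((Tc σ ⊆ Tc π) × length (Tc σ) ≡ r)
          ⊎ (length (TcInter σ π) ≡ r ∸ 1 × length (Tc σ) ≡ r))
lemma10 n r 2≤r 2r∸1≤n =
  let π , π-perm , wHπ≡2r∸1 , I≡interCard = I-attained-at-idPerm (2 * r ∸ 1) r
        (rotation 2r∸1≤n) (idPerm n) (rotation-isPerm 2r∸1≤n) idPerm-isPerm
        (trans (dist-sym (rotation 2r∸1≤n) (idPerm n))
               (wH-rotation 2r∸1≤n (≤-trans 2≤r (n≤2*n∸1 r))))
  in π , π-perm , wHπ≡2r∸1 , I≡interCard , interCard-idPerm≡sum-levels r π ,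
     -- the classification holds for every vector σ, permutation or not
     λ σ _ → Comparison.Tc-classification π σ r wHπ≡2r∸1
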